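{- Fix a prime $p\ge7$ and one of the six hypergeometric data described in the context, with the notation defined there. For $i\in\{1,2\}$ and each integer $1\le k\le u_1+1$, let \[ D^{(i)}_k=\Big((-t+k-pq_1')R_i(t)\Big)\Big|_{t=k-pq_1'} \] be the residue-type coefficient of $R_i$ at $t=k-pq_1'$. Then there exists $\delta^{(i)}_k\in\mathbb{Z}_p$ such that $D^{(i)}_k=p^{3-i}\delta^{(i)}_k$.
   Context: Let $(r,r^\ast,q)$ be one of $\left(\tfrac12,\tfrac12,\tfrac43\right), \left(\tfrac12,\tfrac12,\tfrac76\right), \left(\tfrac12,\tfrac13,\tfrac76\right), \left(\tfrac12,\tfrac13,\tfrac54\right), \left(\tfrac12,\tfrac14,\tfrac76\right), \left(\tfrac12,\tfrac12,\tfrac54\right)$, and $\alpha=\{r,1-r,r^\ast,1-r^\ast\}$, $\beta=\{1,1,q,2-q\}$ (multisets). For $x\in\mathbb{Z}_p$ let $[x]_0\in\{0,\dots,p-1\}$ be its first $p$-adic digit and $x'=(x+[-x]_0)/p$ (Dwork's dash operation). Label $\alpha=\{r_1,\dots,r_4\}$, $\beta=\{q_1,\dots,q_4\}$ so that $r_1'\le\dots\le r_4'$ and $q_1'\le\dots\le q_4'$; set $t_j=[-r_j]_0$, $u_j=[-q_j]_0$. For a variable $t$ and integer $n\ge0$, $(x)_n=x(x+1)\cdots(x+n-1)$ is a polynomial. For $i\in\{1,2\}$ define the rational function \[ R_i(t)=\frac{\prod_{j=1}^4(-t+1-pr_j')_{t_j}\,(-t+q_1)_{u_1+1}}{(-t+1-pq_1')_{u_1+1}\,\big((t)_p\big)^{i+1}}.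 \] -}

module Defs where

open import Data.Nat as ℕ using (ℕ; zero; suc)
open import Data.Nat.Divisibility using (_∣?_)
open import Data.Integer as ℤ using (ℤ; +_; +[1+_]; -[1+_])
open import Data.Rational using (ℚ; ↥_; ↧ₙ_; _/_; _+_; _*_; -_; _-_; 0ℚ; 1ℚ)
open import Data.Bool using (Bool; if_then_else_)
open import Data.Fin using (Fin)
open import Data.List using (List; []; _∷_)
open import Data.Vec using (Vec; lookup; foldr)
open import Relation.Nullary.Decidable using (does)

ℕ→ℚ : ℕ → ℚ
ℕ→ℚ n = (+ n) / 1

-- inverse of a rational; junk value 0 at 0 (only used at nonzero arguments)
inv : ℚ → ℚ
inv x with ↥ x
... | + zero   = 0ℚ
... | +[1+ n ] = (+ (↧ₙ x)) / suc n
... | -[1+ n ] = - ((+ (↧ₙ x)) / suc n)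

-- first a ≥ start (within fuel) satisfying P, default 0
find : ℕ → ℕ → (ℕ → Bool) → ℕ
find zero    a P = 0
find (suc f) a P = if P a then a else find f (suc a) P

-- first p-adic digit [x]_0 of x ∈ ℚ ∩ ℤ_p: the unique a ∈ {0,…,p-1}
-- with x ≡ a (mod p), i.e. p ∣ (num x − a · den x)
digit0 : ℕ → ℚ → ℕ
digit0 p x = find p 0 (λ a → does (p ∣? ℤ.∣ (↥ x) ℤ.- (+ a) ℤ.* (+ (↧ₙ x)) ∣))

dash : ℕ → ℚ → ℚ
dash p x = (x + ℕ→ℚ (digit0 p (- x))) * inv (ℕ→ℚ p)

poch : ℚ → ℕ → ℚ
poch x zero    = 1ℚ
poch x (suc n) = poch x n * (x + ℕ→ℚ n)

pow : ℚ → ℕ → ℚ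
pow x zero    = 1ℚ
pow x (suc n) = pow x n * x

data Datum : Set where
  d1 d2 d3 d4 d5 d6 : Datum

rat : ℤ → ℕ → ℚ
rat n zero    = 0ℚ
rat n (suc d) = n / suc d

rOf : Datum → ℚ
rOf _ = rat (+ 1) 2

r*Of : Datum → ℚ
r*Of d1 = rat (+ 1) 2
r*Of d2 = rat (+ 1) 2
r*Of d3 = rat (+ 1) 3
r*Of d4 = rat (+ 1) 3
r*Of d5 = rat (+ 1) 4
r*Of d6 = rat (+ 1) 2

qOf : Datum → ℚ
qOf d1 = rat (+ 4) 3
qOf d2 = rat (+ 7) 6
qOf d3 = rat (+ 7) 6
qOf d4 = rat (+ 5) 4
qOf d5 = rat (+ 7) 6
qOf d6 = rat (+ 5) 4

αOf : Datum → List ℚ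
αOf d = rOf d ∷ (1ℚ - rOf d) ∷ r*Of d ∷ (1ℚ - r*Of d) ∷ []

βOf : Datum → List ℚ
βOf d = 1ℚ ∷ 1ℚ ∷ qOf d ∷ (ℕ→ℚ 2 - qOf d) ∷ []

-- With t0 = k − p q₁', the denominator factor (−t+1−pq₁')_{u₁+1} splits as
--   (−t+1−pq₁')_{k−1} · (−t+k−pq₁') · (−t+k+1−pq₁')_{u₁+1−k},
-- so ((−t+k−pq₁') R_i(t))|_{t=t0} = N(t0) / [ (−t0+1−pq₁')_{k−1} ·
--   (−t0+k+1−pq₁')_{u₁+1−k} · ((t0)_p)^{i+1} ],
-- where N(t) = ∏_j (−t+1−p r_j')_{t_j} · (−t+q₁)_{u₁+1}.
Dcoef : (p : ℕ) (rs qs : Vec ℚ 4) (i k : ℕ) → ℚ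
Dcoef p rs qs i k = num * inv den
  where
  P  = ℕ→ℚ p
  q1 = lookup qs Fin.zero
  u₁ = digit0 p (- q1)
  t0 = ℕ→ℚ k - P * dash p q1
  fac : ℚ → ℚ
  fac r = poch (- t0 + 1ℚ - P * dash p r) (digit0 p (- r))
  num = foldr _ (λ r acc → fac r * acc) 1ℚ rs * poch (- t0 + q1) (suc u₁)
  den = poch (- t0 + 1ℚ - P * dash p q1) (k ℕ.∸ 1)
      * poch (- t0 + ℕ→ℚ (suc k) - P * dash p q1) (suc u₁ ℕ.∸ k)
      * pow (poch t0 p) (suc i)

-- Write s = q₁′, u = u₁ = [-q₁]₀ and t₀ = k − ps, so that D⁽ⁱ⁾ₖ is the numerator
-- ∏ᵣ (−t₀+1−pr′)_{tᵣ} · (−t₀+q₁)_{u+1} over (1−k)_{k−1} · (1)_{u+1−k} · ((t₀)_p)^{i+1}.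
-- When tᵣ > u, the factor (−t₀+1−pr′)_{tᵣ} contains the term of index k−1, which equals
-- p(s − r′); so the numerator is divisible by p⁴. In the denominator (1−k)_{k−1} and
-- (1)_{u+1−k} are ±(k−1)! and (u+1−k)!, units since u < p, and the only term of (t₀)_p
-- that p divides is the one of index p−k, equal to p(1 − s); if 1 − s is a unit, the
-- denominator is p^{i+1} times a unit, leaving p^{3−i}.
-- For the six data the hypotheses s, r′ ∈ ℤ_(p), 1 − s ∈ ℤ_(p)ˣ and tᵣ > u hold because every
-- element of α ∪ β has denominator dividing 12: writing p = 12m + c, its dash depends only on c
-- and its digit is affine in m, so the four classes of c are verified by evaluation.

module Submission where

module Proof where

  open import Data.Bool using (Bool; true; false)
  open import Data.Empty using (⊥-elim)
  import Data.Fin as Fin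
  open import Data.Integer as ℤ using (ℤ; +_; +[1+_]; -[1+_])
  import Data.Integer.Divisibility.Signed as ℤ
  import Data.Integer.Properties as ℤ
  open import Data.List using (List; _∷_; [])
  open import Data.List.Membership.Propositional using (_∈_)
  open import Data.List.Relation.Binary.Permutation.Propositional using (_↭_; ↭-sym)
  open import Data.List.Relation.Binary.Permutation.Propositional.Properties using (All-resp-↭; ∈-resp-↭)
  open import Data.List.Relation.Unary.All as All using (All; all?)
  open import Data.List.Relation.Unary.Any using (here; there)
  open import Data.Nat as ℕ using (ℕ; zero; suc; _≤_; _<_; _∸_; _^_; _!; z≤n; s≤s)
  import Data.Nat.Coprimality as Coprime
  open import Data.Nat.Divisibility
  open import Data.Nat.DivMod using (_%_; _/_; m≡m%n+[m/n]*n; m%n<n)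
  open import Data.Nat.Primality using (Prime; euclidsLemma; ¬prime[1]; prime⇒nonZero; composite)
  import Data.Nat.Properties as ℕ
  open import Data.Product using (Σ; _×_; _,_; proj₁; proj₂)
  open import Data.Rational as ℚ using (ℚ; mkℚ; ↥_; ↧_; ↧ₙ_; _+_; _*_; -_; _-_; 0ℚ; 1ℚ; 1/_)
  import Data.Rational.Properties as ℚ
  open import Data.Rational.Solver using (module +-*-Solver)
  open import Data.Sum using (_⊎_; inj₁; inj₂; [_,_]′)
  open import Data.Vec as Vec using (Vec; []; _∷_)
  open import Data.Vec.Relation.Unary.All as VAll using ([]; _∷_)
  import Data.Vec.Relation.Unary.All.Properties as VAll
  open import Function using (_∘_)
  open import Relation.Binary.PropositionalEquality
  open import Relation.Nullary using (¬_; Dec; yes; no)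
  open import Relation.Nullary.Decidable using (does; dec-true; dec-false; _×-dec_; _→-dec_; from-yes)
  open import Defs

  open +-*-Solver

  ℕ→ℚ≡mkℚ : ∀ n → ℕ→ℚ n ≡ mkℚ (+ n) 0 (Coprime.sym (Coprime.1-coprimeTo n))
  ℕ→ℚ≡mkℚ n = ℚ.normalize-coprime (Coprime.sym (Coprime.1-coprimeTo n))

  ↥-ℕ→ℚ : ∀ n → ↥ (ℕ→ℚ n) ≡ + n
  ↥-ℕ→ℚ n = cong ↥_ (ℕ→ℚ≡mkℚ n)

  ↧ₙ-ℕ→ℚ : ∀ n → ↧ₙ (ℕ→ℚ n) ≡ 1
  ↧ₙ-ℕ→ℚ n = cong ↧ₙ_ (ℕ→ℚ≡mkℚ n)

  ℕ→ℚ-homo-+ : ∀ m n → ℕ→ℚ (m ℕ.+ n) ≡ ℕ→ℚ m + ℕ→ℚ n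
  ℕ→ℚ-homo-+ m n = sym (trans (cong₂ _+_ (ℕ→ℚ≡mkℚ m) (ℕ→ℚ≡mkℚ n))
    (cong (ℚ._/ 1) (cong₂ ℤ._+_ (ℤ.*-identityʳ (+ m)) (ℤ.*-identityʳ (+ n)))))

  ℕ→ℚ-homo-* : ∀ m n → ℕ→ℚ (m ℕ.* n) ≡ ℕ→ℚ m * ℕ→ℚ n
  ℕ→ℚ-homo-* m n = sym (trans (cong₂ _*_ (ℕ→ℚ≡mkℚ m) (ℕ→ℚ≡mkℚ n))
    (cong (ℚ._/ 1) (sym (ℤ.pos-* m n))))

  ℕ→ℚ-≢0 : ∀ {n} → n ≢ 0 → ℕ→ℚ n ≢ 0ℚ
  ℕ→ℚ-≢0 {n} n≢0 eq = n≢0 (ℤ.+-injective (trans (sym (↥-ℕ→ℚ n)) (cong ↥_ eq)))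

  inv≡1/ : ∀ x .{{_ : ℚ.NonZero x}} → inv x ≡ 1/ x
  inv≡1/ (mkℚ +[1+ n ] d-1 c) = ℚ.normalize-coprime (Coprime.sym c)
  inv≡1/ (mkℚ -[1+ n ] d-1 c) = cong -_ (ℚ.normalize-coprime (Coprime.sym c))

  inv-inverseʳ : ∀ x → x ≢ 0ℚ → x * inv x ≡ 1ℚ
  inv-inverseʳ x x≢0 = trans (cong (x *_) (inv≡1/ x)) (ℚ.*-inverseʳ x)
    where instance _ = ℚ.≢-nonZero x≢0

  x≡y*d⇒x*inv[d]≡y : ∀ {x y d} → d ≢ 0ℚ → x ≡ y * d → x * inv d ≡ y
  x≡y*d⇒x*inv[d]≡y {y = y} {d} d≢0 refl = begin
    y * d * inv d    ≡⟨ ℚ.*-assoc y d (inv d) ⟩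
    y * (d * inv d)  ≡⟨ cong (y *_) (inv-inverseʳ d d≢0) ⟩
    y * 1ℚ           ≡⟨ ℚ.*-identityʳ y ⟩
    y                ∎
    where open ≡-Reasoning

  *-≢0 : ∀ {x y} → x ≢ 0ℚ → y ≢ 0ℚ → x * y ≢ 0ℚ
  *-≢0 {x} {y} x≢0 y≢0 xy≡0 = y≢0 (begin
    y                ≡⟨ ℚ.*-identityˡ y ⟨
    1ℚ * y           ≡⟨ cong (_* y) (trans (ℚ.*-comm (inv x) x) (inv-inverseʳ x x≢0)) ⟨
    inv x * x * y    ≡⟨ ℚ.*-assoc (inv x) x y ⟩
    inv x * (x * y)  ≡⟨ cong (inv x *_) xy≡0 ⟩
    inv x * 0ℚ       ≡⟨ ℚ.*-zeroʳ (inv x) ⟩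
    0ℚ               ∎)
    where open ≡-Reasoning

  pow-* : ∀ x y n → pow (x * y) n ≡ pow x n * pow y n
  pow-* x y zero    = refl
  pow-* x y (suc n) = trans (cong (_* (x * y)) (pow-* x y n))
    (solve 4 (λ a b c d → (a :* b) :* (c :* d) := (a :* c) :* (b :* d)) refl (pow x n) (pow y n) x y)

  pow-ℕ→ℚ : ∀ m n → pow (ℕ→ℚ m) n ≡ ℕ→ℚ (m ^ n)
  pow-ℕ→ℚ m zero    = refl
  pow-ℕ→ℚ m (suc n) = begin
    pow (ℕ→ℚ m) n * ℕ→ℚ m  ≡⟨ cong (_* ℕ→ℚ m) (pow-ℕ→ℚ m n) ⟩
    ℕ→ℚ (m ^ n) * ℕ→ℚ m    ≡⟨ ℕ→ℚ-homo-* (m ^ n) m ⟨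
    ℕ→ℚ (m ^ n ℕ.* m)      ≡⟨ cong ℕ→ℚ (ℕ.*-comm (m ^ n) m) ⟩
    ℕ→ℚ (m ^ suc n)        ∎
    where open ≡-Reasoning

  find-≡ : ∀ f st (test : ℕ → Bool) {a} → st ≤ a → a < st ℕ.+ f → test a ≡ true
         → (∀ {c} → st ≤ c → c < a → test c ≡ false) → find f st test ≡ a
  find-≡ zero    st test st≤a a<st+0 _ _ = ⊥-elim (ℕ.<⇒≱ a<st+0 (subst (_≤ _) (sym (ℕ.+-identityʳ st)) st≤a))
  find-≡ (suc f) st test {a} st≤a a<st+1+f test-a earlier with st ℕ.≟ a
  ... | yes refl rewrite test-a = refl
  ... | no st≢a rewrite earlier ℕ.≤-refl (ℕ.≤∧≢⇒< st≤a st≢a) =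
    find-≡ f (suc st) test (ℕ.≤∧≢⇒< st≤a st≢a) (subst (a <_) (ℕ.+-suc st f) a<st+1+f) test-a
      (λ st<c → earlier (ℕ.<⇒≤ st<c))

  find-< : ∀ f st (test : ℕ → Bool) → find f st test < st ℕ.+ f ⊎ find f st test ≡ 0
  find-< zero    st test = inj₂ refl
  find-< (suc f) st test with test st
  ... | true  = inj₁ (ℕ.m<m+n st (s≤s z≤n))
  ... | false with find-< f (suc st) test
  ...   | inj₁ <st+f = inj₁ (subst (find f (suc st) test <_) (sym (ℕ.+-suc st f)) <st+f)
  ...   | inj₂ ≡0    = inj₂ ≡0

  digit0<p : ∀ {p} → 0 < p → ∀ x → digit0 p x < p
  digit0<p {p} 0<p x with find-< p 0 (λ a → does (p ∣? ℤ.∣ (↥ x) ℤ.- (+ a) ℤ.* (+ (↧ₙ x)) ∣))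
  ... | inj₁ <p = <p
  ... | inj₂ ≡0 = subst (_< p) (sym ≡0) 0<p

  module PAdic {p : ℕ} (p-prime : Prime p) where

    P : ℚ
    P = ℕ→ℚ p

    record ℤₚ (x : ℚ) : Set where
      constructor integral
      field p∤↧ : ¬ p ∣ ↧ₙ x

    record ℤₚˣ (x : ℚ) : Set where
      constructor unit
      field
        ∈ℤₚ : ℤₚ x
        p∤↥ : ¬ p ∣ ℤ.∣ ↥ x ∣

    record p^_∣_ (e : ℕ) (x : ℚ) : Set where
      constructor mk∣
      field
        quotient      : ℚ
        quotient∈ℤₚ   : ℤₚ quotient
        factorisation : x ≡ ℕ→ℚ (p ^ e) * quotient

    private
      p∣ : ℤ → Set
      p∣ z = p ∣ ℤ.∣ z ∣

      p∣-resp-* : ∀ a g {b} → a ℤ.* g ≡ b → p∣ a → p∣ b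
      p∣-resp-* a g refl h = subst (p ∣_) (sym (ℤ.abs-* a g)) (∣m⇒∣m*n ℤ.∣ g ∣ h)

      p∣-* : ∀ a b → p∣ (a ℤ.* b) → p∣ a ⊎ p∣ b
      p∣-* a b h = euclidsLemma ℤ.∣ a ∣ ℤ.∣ b ∣ p-prime (subst (p ∣_) (ℤ.abs-* a b) h)

      p∣-split : ∀ a g b c → a ℤ.* g ≡ b ℤ.* c → p∣ a → p∣ b ⊎ p∣ c
      p∣-split a g b c eq h = p∣-* b c (p∣-resp-* a g eq h)

    p∤1 : ¬ p ∣ 1
    p∤1 h = ¬prime[1] (subst Prime (∣1⇒≡1 h) p-prime)

    p∤n : ∀ {n} → 0 < n → n < p → ¬ p ∣ n
    p∤n {suc n} _ n<p h = ℕ.<⇒≱ n<p (∣⇒≤ h)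

    P≢0 : P ≢ 0ℚ
    P≢0 = ℕ→ℚ-≢0 (ℕ.≢-nonZero⁻¹ p {{prime⇒nonZero p-prime}})

    ℤₚ-ℕ→ℚ : ∀ n → ℤₚ (ℕ→ℚ n)
    ℤₚ-ℕ→ℚ n = integral (subst (λ d → ¬ p ∣ d) (sym (↧ₙ-ℕ→ℚ n)) p∤1)

    ℤₚ-1 : ℤₚ 1ℚ
    ℤₚ-1 = integral p∤1

    ℤₚ-* : ∀ {x y} → ℤₚ x → ℤₚ y → ℤₚ (x * y)
    ℤₚ-* {x} {y} (integral x∈) (integral y∈) = integral λ h →
      [ x∈ , y∈ ]′ (p∣-split (↧ (x * y)) _ (↧ x) (↧ y) (ℚ.↧-* x y) h)

    ℤₚ-+ : ∀ {x y} → ℤₚ x → ℤₚ y → ℤₚ (x + y)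
    ℤₚ-+ {x} {y} (integral x∈) (integral y∈) = integral λ h →
      [ x∈ , y∈ ]′ (p∣-split (↧ (x + y)) _ (↧ x) (↧ y) (ℚ.↧-+ x y) h)

    ℤₚ-neg : ∀ {x} → ℤₚ x → ℤₚ (- x)
    ℤₚ-neg {x} (integral x∈) = integral λ h → x∈ (subst p∣ (ℚ.↧-neg x) h)

    ℤₚ-- : ∀ {x y} → ℤₚ x → ℤₚ y → ℤₚ (x - y)
    ℤₚ-- x∈ y∈ = ℤₚ-+ x∈ (ℤₚ-neg y∈)

    ℤₚˣ-1 : ℤₚˣ 1ℚ
    ℤₚˣ-1 = unit ℤₚ-1 p∤1

    ℤₚˣ-ℕ→ℚ : ∀ {n} → ¬ p ∣ n → ℤₚˣ (ℕ→ℚ n)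
    ℤₚˣ-ℕ→ℚ {n} p∤n = unit (ℤₚ-ℕ→ℚ n) λ h → p∤n (subst p∣ (↥-ℕ→ℚ n) h)

    ℤₚˣ-* : ∀ {x y} → ℤₚˣ x → ℤₚˣ y → ℤₚˣ (x * y)
    ℤₚˣ-* {x} {y} (unit x∈ x∤) (unit y∈ y∤) = unit (ℤₚ-* x∈ y∈) λ h →
      [ x∤ , y∤ ]′ (p∣-split (↥ (x * y)) _ (↥ x) (↥ y) (ℚ.↥-* x y) h)

    ℤₚˣ-neg : ∀ {x} → ℤₚˣ x → ℤₚˣ (- x)
    ℤₚˣ-neg {x} (unit x∈ x∤) = unit (ℤₚ-neg x∈) λ h →
      x∤ (subst (p ∣_) (trans (cong ℤ.∣_∣ (ℚ.↥-neg x)) (ℤ.∣-i∣≡∣i∣ (↥ x))) h)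

    ℤₚˣ-pow : ∀ {x} n → ℤₚˣ x → ℤₚˣ (pow x n)
    ℤₚˣ-pow zero    _      = ℤₚˣ-1
    ℤₚˣ-pow (suc n) x-unit = ℤₚˣ-* (ℤₚˣ-pow n x-unit) x-unit

    ℤₚˣ⇒≢0 : ∀ {x} → ℤₚˣ x → x ≢ 0ℚ
    ℤₚˣ⇒≢0 (unit _ x∤) refl = x∤ (p ∣0)

    ℤₚˣ⇒inv∈ℤₚ : ∀ {x} → ℤₚˣ x → ℤₚ (inv x)
    ℤₚˣ⇒inv∈ℤₚ {mkℚ (+ zero) _ _}   (unit _ x∤) = ⊥-elim (x∤ (p ∣0))
    ℤₚˣ⇒inv∈ℤₚ {mkℚ +[1+ n ] d _} (unit _ x∤) = integral λ h →
      x∤ (p∣-resp-* (↧ (+ suc d ℚ./ suc n)) _ (ℚ.↧-/ (+ suc d) (suc n)) h)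
    ℤₚˣ⇒inv∈ℤₚ {mkℚ -[1+ n ] d _} (unit _ x∤) = integral λ h →
      x∤ (p∣-resp-* (↧ (+ suc d ℚ./ suc n)) _ (ℚ.↧-/ (+ suc d) (suc n)) (subst p∣ (ℚ.↧-neg (+ suc d ℚ./ suc n)) h))

    ℤₚ⇒p^0∣ : ∀ {x} → ℤₚ x → p^ 0 ∣ x
    ℤₚ⇒p^0∣ {x} x∈ = mk∣ x x∈ (sym (ℚ.*-identityˡ x))

    p∣P* : ∀ {y} → ℤₚ y → p^ 1 ∣ (P * y)
    p∣P* {y} y∈ = mk∣ y y∈ (cong (λ n → ℕ→ℚ n * y) (sym (ℕ.*-identityʳ p)))

    p^∣⇒ℤₚ : ∀ {e x} → p^ e ∣ x → ℤₚ x
    p^∣⇒ℤₚ {e} (mk∣ y y∈ refl) = ℤₚ-* (ℤₚ-ℕ→ℚ (p ^ e)) y∈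

    p^∣-* : ∀ {e f x y} → p^ e ∣ x → p^ f ∣ y → p^ (e ℕ.+ f) ∣ (x * y)
    p^∣-* {e} {f} (mk∣ x′ x′∈ refl) (mk∣ y′ y′∈ refl) = mk∣ (x′ * y′) (ℤₚ-* x′∈ y′∈) (begin
      pᵉ * x′ * (pᶠ * y′)              ≡⟨ solve 4 (λ a b c d → (a :* b) :* (c :* d) := (a :* c) :* (b :* d)) refl pᵉ x′ pᶠ y′ ⟩
      pᵉ * pᶠ * (x′ * y′)              ≡⟨ cong (_* (x′ * y′)) (trans (cong ℕ→ℚ (ℕ.^-distribˡ-+-* p e f)) (ℕ→ℚ-homo-* (p ^ e) (p ^ f))) ⟨
      ℕ→ℚ (p ^ (e ℕ.+ f)) * (x′ * y′)  ∎)
      where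
      open ≡-Reasoning
      pᵉ = ℕ→ℚ (p ^ e)
      pᶠ = ℕ→ℚ (p ^ f)

    p^∣-*ℤₚ : ∀ {e x z} → p^ e ∣ x → ℤₚ z → p^ e ∣ (x * z)
    p^∣-*ℤₚ {e} {x} {z} p^e∣x z∈ = subst (λ e′ → p^ e′ ∣ (x * z)) (ℕ.+-identityʳ e) (p^∣-* p^e∣x (ℤₚ⇒p^0∣ z∈))

    ℤₚ-*-p^∣ : ∀ {e x z} → ℤₚ z → p^ e ∣ x → p^ e ∣ (z * x)
    ℤₚ-*-p^∣ {x = x} {z} z∈ p^e∣x = subst (λ y → p^ _ ∣ y) (ℚ.*-comm x z) (p^∣-*ℤₚ p^e∣x z∈)

    p^∣-/ : ∀ {e f x w} → p^ (e ℕ.+ f) ∣ x → ℤₚˣ w → p^ e ∣ (x * inv (ℕ→ℚ (p ^ f) * w))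
    p^∣-/ {e} {f} {w = w} (mk∣ y y∈ refl) w-unit =
      mk∣ (y * inv w) (ℤₚ-* y∈ (ℤₚˣ⇒inv∈ℤₚ w-unit)) (x≡y*d⇒x*inv[d]≡y (*-≢0 pᶠ≢0 w≢0) (begin
        ℕ→ℚ (p ^ (e ℕ.+ f)) * y      ≡⟨ cong (_* y) (trans (cong ℕ→ℚ (ℕ.^-distribˡ-+-* p e f)) (ℕ→ℚ-homo-* (p ^ e) (p ^ f))) ⟩
        pᵉ * pᶠ * y                  ≡⟨ ℚ.*-identityʳ _ ⟨
        pᵉ * pᶠ * y * 1ℚ             ≡⟨ cong (pᵉ * pᶠ * y *_) (inv-inverseʳ w w≢0) ⟨
        pᵉ * pᶠ * y * (w * inv w)    ≡⟨ solve 5 (λ a b c d d⁻¹ → a :* b :* c :* (d :* d⁻¹) := a :* (c :* d⁻¹) :* (b :* d)) refl pᵉ pᶠ y w (inv w) ⟩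
        pᵉ * (y * inv w) * (pᶠ * w)  ∎))
      where
      open ≡-Reasoning
      pᵉ = ℕ→ℚ (p ^ e)
      pᶠ = ℕ→ℚ (p ^ f)
      w≢0 = ℤₚˣ⇒≢0 w-unit
      pᶠ≢0 : pᶠ ≢ 0ℚ
      pᶠ≢0 = ℕ→ℚ-≢0 (ℕ.≢-nonZero⁻¹ (p ^ f) {{ℕ.m^n≢0 p f {{prime⇒nonZero p-prime}}}})

    p∣⇒p∣↥ : ∀ {x} → p^ 1 ∣ x → p ∣ ℤ.∣ ↥ x ∣
    p∣⇒p∣↥ (mk∣ y (integral y∈) refl) = go _ (ℚ.↥-* p¹ y) (ℚ.↧-* p¹ y)
      where
      p¹ = ℕ→ℚ (p ^ 1)
      p∣↥p¹ : p ∣ ℤ.∣ ↥ p¹ ∣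
      p∣↥p¹ = subst (p ∣_) (cong ℤ.∣_∣ (sym (↥-ℕ→ℚ (p ^ 1)))) (∣m⇒∣m*n 1 ∣-refl)
      go : ∀ g → ↥ (p¹ * y) ℤ.* g ≡ ↥ p¹ ℤ.* ↥ y → ↧ (p¹ * y) ℤ.* g ≡ ↧ p¹ ℤ.* ↧ y
         → p ∣ ℤ.∣ ↥ (p¹ * y) ∣
      go g ↥≡ ↧≡ with p∣-split (↥ p¹ ℤ.* ↥ y) (+ 1) (↥ (p¹ * y)) g (trans (ℤ.*-identityʳ _) (sym ↥≡))
                        (p∣-resp-* (↥ p¹) (↥ y) refl p∣↥p¹)
      ... | inj₁ p∣↥ = p∣↥
      ... | inj₂ p∣g = ⊥-elim ([ ℤₚ.p∤↧ (ℤₚ-ℕ→ℚ (p ^ 1)) , y∈ ]′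
                         (p∣-split g (↧ (p¹ * y)) (↧ p¹) (↧ y) (trans (ℤ.*-comm g _) ↧≡) p∣g))

    ℤₚˣ-+-p∣ : ∀ {a b} → ℤₚˣ a → p^ 1 ∣ b → ℤₚˣ (a + b)
    ℤₚˣ-+-p∣ {a} {b} (unit a∈ a∤) p∣b = unit (ℤₚ-+ a∈ (p^∣⇒ℤₚ p∣b)) λ h →
      [ a∤ , ℤₚ.p∤↧ (p^∣⇒ℤₚ p∣b) ]′ (p∣-* (↥ a) (↧ b) (p∣↥a↧b h))
      where
      p∣↥a↧b : p ∣ ℤ.∣ ↥ (a + b) ∣ → p ∣ ℤ.∣ ↥ a ℤ.* ↧ b ∣
      p∣↥a↧b h = ℤ.∣⇒∣ᵤ (ℤ.∣m+n∣n⇒∣m {+ p} {↥ a ℤ.* ↧ b} {↥ b ℤ.* ↧ a}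
        (ℤ.∣ᵤ⇒∣ (p∣-resp-* (↥ (a + b)) _ (ℚ.↥-+ a b) h))
        (ℤ.∣ᵤ⇒∣ (p∣-resp-* (↥ b) (↧ a) refl (p∣⇒p∣↥ p∣b))))

    poch-ℤₚ : ∀ {x} n → ℤₚ x → ℤₚ (poch x n)
    poch-ℤₚ zero    _  = ℤₚ-1
    poch-ℤₚ (suc n) x∈ = ℤₚ-* (poch-ℤₚ n x∈) (ℤₚ-+ x∈ (ℤₚ-ℕ→ℚ n))

    poch-ℤₚˣ : ∀ {x} n → (∀ {j} → j < n → ℤₚˣ (x + ℕ→ℚ j)) → ℤₚˣ (poch x n)
    poch-ℤₚˣ zero    _     = ℤₚˣ-1
    poch-ℤₚˣ (suc n) terms = ℤₚˣ-* (poch-ℤₚˣ n (terms ∘ ℕ.m<n⇒m<1+n)) (terms (ℕ.n<1+n n))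

    poch-p∣ : ∀ {x j} n → j < n → p^ 1 ∣ (x + ℕ→ℚ j) → p^ 1 ∣ poch x n
    poch-p∣ {x} {j} n j<n p∣term = go n j<n
      where
      x∈ : ℤₚ x
      x∈ = subst ℤₚ (solve 2 (λ x j → x :+ j :- j := x) refl x (ℕ→ℚ j)) (ℤₚ-- (p^∣⇒ℤₚ p∣term) (ℤₚ-ℕ→ℚ j))
      go : ∀ n → j < n → p^ 1 ∣ poch x n
      go (suc n) j<1+n with j ℕ.≟ n
      ... | yes refl = ℤₚ-*-p^∣ (poch-ℤₚ j x∈) p∣term
      ... | no j≢n  = p^∣-*ℤₚ (go n (ℕ.≤∧≢⇒< (ℕ.≤-pred j<1+n) j≢n)) (ℤₚ-+ x∈ (ℤₚ-ℕ→ℚ n))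

    poch-p*ℤₚˣ : ∀ {x j₀ w} n → j₀ < n → x + ℕ→ℚ j₀ ≡ P * w → ℤₚˣ w
               → (∀ {j} → j < n → j ≢ j₀ → ℤₚˣ (x + ℕ→ℚ j))
               → Σ ℚ λ B → ℤₚˣ B × poch x n ≡ P * B
    poch-p*ℤₚˣ {x} {j₀} {w} (suc n) j₀<1+n term≡ w-unit others with j₀ ℕ.≟ n
    ... | yes refl = poch x j₀ * w
                   , ℤₚˣ-* (poch-ℤₚˣ j₀ (λ j<j₀ → others (ℕ.m<n⇒m<1+n j<j₀) (ℕ.<⇒≢ j<j₀))) w-unit
                   , trans (cong (poch x j₀ *_) term≡) (solve 3 (λ a b c → a :* (b :* c) := b :* (a :* c)) refl (poch x j₀) P w)
    ... | no j₀≢n with poch-p*ℤₚˣ n (ℕ.≤∧≢⇒< (ℕ.≤-pred j₀<1+n) j₀≢n) term≡ w-unit (λ j<n → others (ℕ.m<n⇒m<1+n j<n))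
    ...   | B , B-unit , poch≡ = B * (x + ℕ→ℚ n)
                               , ℤₚˣ-* B-unit (others (ℕ.n<1+n n) (j₀≢n ∘ sym))
                               , trans (cong (_* (x + ℕ→ℚ n)) poch≡) (ℚ.*-assoc P B _)

    poch[-n]ₙ-ℤₚˣ : ∀ {n} → n < p → ℤₚˣ (poch (- ℕ→ℚ n) n)
    poch[-n]ₙ-ℤₚˣ {n} n<p = poch-ℤₚˣ n term
      where
      term : ∀ {j} → j < n → ℤₚˣ (- ℕ→ℚ n + ℕ→ℚ j)
      term {j} j<n = subst ℤₚˣ (sym term≡)
        (ℤₚˣ-neg (ℤₚˣ-ℕ→ℚ (p∤n (ℕ.m<n⇒0<n∸m j<n) (ℕ.≤-<-trans (ℕ.m∸n≤m n j) n<p))))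
        where
        term≡ : - ℕ→ℚ n + ℕ→ℚ j ≡ - ℕ→ℚ (n ∸ j)
        term≡ = begin
          - ℕ→ℚ n + ℕ→ℚ j                    ≡⟨ cong (λ m → - ℕ→ℚ m + ℕ→ℚ j) (ℕ.m+[n∸m]≡n (ℕ.<⇒≤ j<n)) ⟨
          - ℕ→ℚ (j ℕ.+ (n ∸ j)) + ℕ→ℚ j      ≡⟨ cong (λ m → - m + ℕ→ℚ j) (ℕ→ℚ-homo-+ j (n ∸ j)) ⟩
          - (ℕ→ℚ j + ℕ→ℚ (n ∸ j)) + ℕ→ℚ j    ≡⟨ solve 2 (λ a b → :- (a :+ b) :+ a := :- b) refl (ℕ→ℚ j) (ℕ→ℚ (n ∸ j)) ⟩
          - ℕ→ℚ (n ∸ j)                       ∎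
          where open ≡-Reasoning

    poch[1]ₙ-ℤₚˣ : ∀ {n} → n < p → ℤₚˣ (poch 1ℚ n)
    poch[1]ₙ-ℤₚˣ {n} n<p = poch-ℤₚˣ n λ {j} j<n →
      subst ℤₚˣ (ℕ→ℚ-homo-+ 1 j) (ℤₚˣ-ℕ→ℚ (p∤n (s≤s z≤n) (ℕ.≤-<-trans j<n n<p)))

    poch[k-ps]ₚ≡p*unit : ∀ {k s} → 0 < k → k ≤ p → ℤₚ s → ℤₚˣ (1ℚ - s)
                       → Σ ℚ λ B → ℤₚˣ B × poch (ℕ→ℚ k - P * s) p ≡ P * B
    poch[k-ps]ₚ≡p*unit {k} {s} 0<k k≤p s∈ 1-s-unit = poch-p*ℤₚˣ p j₀<p term-j₀ 1-s-unit other-term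
      where
      open ≡-Reasoning
      j₀ = p ∸ k
      j₀<p : j₀ < p
      j₀<p = ℕ.∸-monoʳ-< 0<k k≤p
      term-j₀ : ℕ→ℚ k - P * s + ℕ→ℚ j₀ ≡ P * (1ℚ - s)
      term-j₀ = begin
        ℕ→ℚ k - P * s + ℕ→ℚ j₀      ≡⟨ solve 3 (λ k j ps → k :- ps :+ j := (k :+ j) :- ps) refl (ℕ→ℚ k) (ℕ→ℚ j₀) (P * s) ⟩
        (ℕ→ℚ k + ℕ→ℚ j₀) - P * s    ≡⟨ cong (_- P * s) (trans (sym (ℕ→ℚ-homo-+ k j₀)) (cong ℕ→ℚ (ℕ.m+[n∸m]≡n k≤p))) ⟩
        P - P * s                   ≡⟨ solve 2 (λ P s → P :- P :* s := P :* (con 1ℚ :- s)) refl P s ⟩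
        P * (1ℚ - s)                ∎
      p∤k+j : ∀ {j} → j < p → j ≢ j₀ → ¬ p ∣ k ℕ.+ j
      p∤k+j {j} j<p j≢j₀ (divides zero k+j≡0) = ℕ.<⇒≢ (ℕ.<-≤-trans 0<k (ℕ.m≤m+n k j)) (sym k+j≡0)
      p∤k+j {j} j<p j≢j₀ (divides (suc zero) k+j≡p) =
        j≢j₀ (trans (sym (ℕ.m+n∸m≡n k j)) (cong (_∸ k) (trans k+j≡p (ℕ.+-identityʳ p))))
      p∤k+j {j} j<p j≢j₀ (divides (suc (suc q)) k+j≡2p+qp) =
        ℕ.<⇒≱ (ℕ.+-mono-≤-< k≤p j<p) (ℕ.≤-trans (ℕ.m≤m+n (p ℕ.+ p) (q ℕ.* p))
          (ℕ.≤-reflexive (trans (ℕ.+-assoc p p (q ℕ.* p)) (sym k+j≡2p+qp))))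
      other-term : ∀ {j} → j < p → j ≢ j₀ → ℤₚˣ (ℕ→ℚ k - P * s + ℕ→ℚ j)
      other-term {j} j<p j≢j₀ = subst ℤₚˣ (sym term≡)
        (ℤₚˣ-+-p∣ (ℤₚˣ-ℕ→ℚ (p∤k+j j<p j≢j₀)) (p∣P* (ℤₚ-neg s∈)))
        where
        term≡ : ℕ→ℚ k - P * s + ℕ→ℚ j ≡ ℕ→ℚ (k ℕ.+ j) + P * (- s)
        term≡ = trans (solve 4 (λ k j P s → k :- P :* s :+ j := (k :+ j) :+ P :* (:- s)) refl (ℕ→ℚ k) (ℕ→ℚ j) P s)
                      (cong (_+ P * (- s)) (sym (ℕ→ℚ-homo-+ k j)))

    foldr-p^∣ : ∀ {n} (f : ℚ → ℚ) {rs : Vec ℚ n} → VAll.All (λ r → p^ 1 ∣ f r) rs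
              → p^ n ∣ Vec.foldr (λ _ → ℚ) (λ r acc → f r * acc) 1ℚ rs
    foldr-p^∣ f []       = ℤₚ⇒p^0∣ ℤₚ-1
    foldr-p^∣ f (h ∷ hs) = p^∣-* h (foldr-p^∣ f hs)

    digit0-unique : ∀ {x a n} → ↥ x ≡ + a → ¬ p ∣ ↧ₙ x → n < p → p ∣ a ℕ.+ n ℕ.* ↧ₙ x
                  → digit0 p (- x) ≡ n
    digit0-unique {x} {a} {n} ↥x≡a p∤b n<p p∣a+nb =
      find-≡ p 0 _ z≤n n<p (dec-true (p ∣? _) (subst (p ∣_) (sym (value n)) p∣a+nb))
        (λ {c} _ c<n → dec-false (p ∣? _) (λ h → not-earlier c<n (subst (p ∣_) (value c) h)))
      where
      b = ↧ₙ x
      value : ∀ c → ℤ.∣ ↥ (- x) ℤ.- + c ℤ.* + ↧ₙ (- x) ∣ ≡ a ℕ.+ c ℕ.* b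
      value c = begin
        ℤ.∣ ↥ (- x) ℤ.- + c ℤ.* + ↧ₙ (- x) ∣  ≡⟨ cong₂ (λ u v → ℤ.∣ u ℤ.- + c ℤ.* + v ∣) (trans (ℚ.↥-neg x) (cong ℤ.-_ ↥x≡a)) (cong ℤ.∣_∣ (ℚ.↧-neg x)) ⟩
        ℤ.∣ ℤ.- + a ℤ.- + c ℤ.* + b ∣          ≡⟨ cong (λ u → ℤ.∣ ℤ.- + a ℤ.- u ∣) (sym (ℤ.pos-* c b)) ⟩
        ℤ.∣ ℤ.- + a ℤ.- + (c ℕ.* b) ∣          ≡⟨ cong ℤ.∣_∣ (sym (ℤ.neg-distrib-+ (+ a) (+ (c ℕ.* b)))) ⟩
        ℤ.∣ ℤ.- (+ a ℤ.+ + (c ℕ.* b)) ∣        ≡⟨ ℤ.∣-i∣≡∣i∣ (+ a ℤ.+ + (c ℕ.* b)) ⟩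
        a ℕ.+ c ℕ.* b                           ∎
        where open ≡-Reasoning
      not-earlier : ∀ {c} → c < n → ¬ p ∣ a ℕ.+ c ℕ.* b
      not-earlier {c} c<n p∣a+cb =
        [ p∤n (ℕ.m<n⇒0<n∸m c<n) (ℕ.≤-<-trans (ℕ.m∸n≤m n c) n<p) , p∤b ]′
          (euclidsLemma (n ∸ c) b p-prime (∣m+n∣m⇒∣n (subst (p ∣_) split p∣a+nb) p∣a+cb))
        where
        split : a ℕ.+ n ℕ.* b ≡ (a ℕ.+ c ℕ.* b) ℕ.+ (n ∸ c) ℕ.* b
        split = begin
          a ℕ.+ n ℕ.* b                          ≡⟨ cong (λ m → a ℕ.+ m ℕ.* b) (ℕ.m+[n∸m]≡n (ℕ.<⇒≤ c<n)) ⟨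
          a ℕ.+ (c ℕ.+ (n ∸ c)) ℕ.* b            ≡⟨ cong (a ℕ.+_) (ℕ.*-distribʳ-+ b c (n ∸ c)) ⟩
          a ℕ.+ (c ℕ.* b ℕ.+ (n ∸ c) ℕ.* b)      ≡⟨ ℕ.+-assoc a (c ℕ.* b) _ ⟨
          a ℕ.+ c ℕ.* b ℕ.+ (n ∸ c) ℕ.* b        ∎
          where open ≡-Reasoning

    dash-characterisation : ∀ {x y a n} → ↥ x ≡ + a → ℤₚ x → ℤₚ y → n < p → x + ℕ→ℚ n ≡ P * y
                          → digit0 p (- x) ≡ n × dash p x ≡ y
    dash-characterisation {x} {y} {a} {n} ↥x≡a (integral p∤b) y∈ n<p x+n≡Py =
      digit0≡n , x≡y*d⇒x*inv[d]≡y P≢0 (trans x+n≡Py′ (ℚ.*-comm P y))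
      where
      ↥+≡ : ↥ x ℤ.* ↧ (ℕ→ℚ n) ℤ.+ ↥ (ℕ→ℚ n) ℤ.* ↧ x ≡ + (a ℕ.+ n ℕ.* ↧ₙ x)
      ↥+≡ = begin
        ↥ x ℤ.* ↧ (ℕ→ℚ n) ℤ.+ ↥ (ℕ→ℚ n) ℤ.* ↧ x  ≡⟨ cong₂ (λ u v → u ℤ.* v ℤ.+ ↥ (ℕ→ℚ n) ℤ.* ↧ x) ↥x≡a (cong ↧_ (ℕ→ℚ≡mkℚ n)) ⟩
        + a ℤ.* + 1 ℤ.+ ↥ (ℕ→ℚ n) ℤ.* ↧ x        ≡⟨ cong₂ (λ u v → u ℤ.+ v ℤ.* ↧ x) (ℤ.*-identityʳ (+ a)) (↥-ℕ→ℚ n) ⟩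
        + a ℤ.+ + n ℤ.* + ↧ₙ x                   ≡⟨ cong (λ z → + a ℤ.+ z) (ℤ.pos-* n (↧ₙ x)) ⟨
        + a ℤ.+ + (n ℕ.* ↧ₙ x)                   ≡⟨ ℤ.pos-+ a (n ℕ.* ↧ₙ x) ⟨
        + (a ℕ.+ n ℕ.* ↧ₙ x)                     ∎
        where open ≡-Reasoning
      p∣↥[x+n] : p ∣ ℤ.∣ ↥ (x + ℕ→ℚ n) ∣
      p∣↥[x+n] = subst (λ z → p ∣ ℤ.∣ ↥ z ∣) (sym x+n≡Py) (p∣⇒p∣↥ (p∣P* y∈))
      digit0≡n : digit0 p (- x) ≡ n
      digit0≡n = digit0-unique {x} ↥x≡a p∤b n<p
        (subst (p ∣_) (cong ℤ.∣_∣ ↥+≡) (p∣-resp-* (↥ (x + ℕ→ℚ n)) _ (ℚ.↥-+ x (ℕ→ℚ n)) p∣↥[x+n]))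
      x+n≡Py′ : x + ℕ→ℚ (digit0 p (- x)) ≡ P * y
      x+n≡Py′ = subst (λ m → x + ℕ→ℚ m ≡ P * y) (sym digit0≡n) x+n≡Py

    record Admissible {n} (rs : Vec ℚ n) (q₁ : ℚ) : Set where
      field
        q₁∈ℤₚ        : ℤₚ q₁
        q₁′∈ℤₚ       : ℤₚ (dash p q₁)
        1-q₁′∈ℤₚˣ    : ℤₚˣ (1ℚ - dash p q₁)
        r′∈ℤₚ∧digit> : VAll.All (λ r → ℤₚ (dash p r) × digit0 p (- q₁) < digit0 p (- r)) rs

    module Coefficient {n} (rs : Vec ℚ n) (q₁ : ℚ) (admissible : Admissible rs q₁)
                       (k′ : ℕ) (k≤u+1 : suc k′ ≤ digit0 p (- q₁) ℕ.+ 1) where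
      open Admissible admissible
      open ≡-Reasoning

      s  = dash p q₁
      u  = digit0 p (- q₁)
      K  = ℕ→ℚ (suc k′)
      t₀ = K - P * s

      K≡1+k′ : K ≡ 1ℚ + ℕ→ℚ k′
      K≡1+k′ = ℕ→ℚ-homo-+ 1 k′

      k′≤u : k′ ≤ u
      k′≤u = ℕ.≤-pred (subst (suc k′ ≤_) (ℕ.+-comm u 1) k≤u+1)

      u<p : u < p
      u<p = digit0<p (ℕ.>-nonZero⁻¹ p {{prime⇒nonZero p-prime}}) (- q₁)

      t₀∈ℤₚ : ℤₚ t₀
      t₀∈ℤₚ = ℤₚ-- (ℤₚ-ℕ→ℚ (suc k′)) (ℤₚ-* (ℤₚ-ℕ→ℚ p) q₁′∈ℤₚ)

      factor : ℚ → ℚ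
      factor r = poch (- t₀ + 1ℚ - P * dash p r) (digit0 p (- r))

      factor-p∣ : ∀ {r} → ℤₚ (dash p r) × u < digit0 p (- r) → p^ 1 ∣ factor r
      factor-p∣ {r} (r′∈ , u<tᵣ) =
        poch-p∣ (digit0 p (- r)) (ℕ.≤-<-trans k′≤u u<tᵣ) (subst (p^ 1 ∣_) (sym term≡) (p∣P* (ℤₚ-- q₁′∈ℤₚ r′∈)))
        where
        term≡ : - t₀ + 1ℚ - P * dash p r + ℕ→ℚ k′ ≡ P * (s - dash p r)
        term≡ = trans (cong (λ K → - (K - P * s) + 1ℚ - P * dash p r + ℕ→ℚ k′) K≡1+k′)
          (solve 4 (λ k P s r → :- (con 1ℚ :+ k :- P :* s) :+ con 1ℚ :- P :* r :+ k := P :* (s :- r)) refl (ℕ→ℚ k′) P s (dash p r))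

      numerator : ℚ
      numerator = Vec.foldr (λ _ → ℚ) (λ r acc → factor r * acc) 1ℚ rs * poch (- t₀ + q₁) (suc u)

      numerator-divisible : p^ n ∣ numerator
      numerator-divisible = p^∣-*ℤₚ (foldr-p^∣ factor (VAll.map (λ {r} → factor-p∣ {r}) r′∈ℤₚ∧digit>))
                                    (poch-ℤₚ (suc u) (ℤₚ-+ (ℤₚ-neg t₀∈ℤₚ) q₁∈ℤₚ))

      E₁ = poch (- t₀ + 1ℚ - P * s) k′
      E₂ = poch (- t₀ + ℕ→ℚ (suc (suc k′)) - P * s) (u ∸ k′)

      E₁-unit : ℤₚˣ E₁
      E₁-unit = subst (λ x → ℤₚˣ (poch x k′)) (sym base≡) (poch[-n]ₙ-ℤₚˣ (ℕ.≤-<-trans k′≤u u<p))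
        where
        base≡ : - t₀ + 1ℚ - P * s ≡ - ℕ→ℚ k′
        base≡ = trans (cong (λ K → - (K - P * s) + 1ℚ - P * s) K≡1+k′)
          (solve 3 (λ k P s → :- (con 1ℚ :+ k :- P :* s) :+ con 1ℚ :- P :* s := :- k) refl (ℕ→ℚ k′) P s)

      E₂-unit : ℤₚˣ E₂
      E₂-unit = subst (λ x → ℤₚˣ (poch x (u ∸ k′))) (sym base≡) (poch[1]ₙ-ℤₚˣ (ℕ.≤-<-trans (ℕ.m∸n≤m u k′) u<p))
        where
        base≡ : - t₀ + ℕ→ℚ (suc (suc k′)) - P * s ≡ 1ℚ
        base≡ = trans (cong (λ K+1 → - (K - P * s) + K+1 - P * s) (ℕ→ℚ-homo-+ 1 (suc k′)))
          (solve 3 (λ K P s → :- (K :- P :* s) :+ (con 1ℚ :+ K) :- P :* s := con 1ℚ) refl K P s)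

      C-factorisation : Σ ℚ λ B → ℤₚˣ B × poch t₀ p ≡ P * B
      C-factorisation = poch[k-ps]ₚ≡p*unit (s≤s z≤n) (ℕ.≤-trans (s≤s k′≤u) u<p) q₁′∈ℤₚ 1-q₁′∈ℤₚˣ

      B = proj₁ C-factorisation

      W : ℕ → ℚ
      W i = E₁ * E₂ * pow B (suc i)

      W-unit : ∀ i → ℤₚˣ (W i)
      W-unit i = ℤₚˣ-* (ℤₚˣ-* E₁-unit E₂-unit) (ℤₚˣ-pow (suc i) (proj₁ (proj₂ C-factorisation)))

      denominator≡ : ∀ i → E₁ * E₂ * pow (poch t₀ p) (suc i) ≡ ℕ→ℚ (p ^ suc i) * W i
      denominator≡ i = begin
        E₁ * E₂ * pow (poch t₀ p) (suc i)            ≡⟨ cong (λ C → E₁ * E₂ * pow C (suc i)) (proj₂ (proj₂ C-factorisation)) ⟩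
        E₁ * E₂ * pow (P * B) (suc i)                ≡⟨ cong (E₁ * E₂ *_) (trans (pow-* P B (suc i)) (cong (_* pow B (suc i)) (pow-ℕ→ℚ p (suc i)))) ⟩
        E₁ * E₂ * (ℕ→ℚ (p ^ suc i) * pow B (suc i))  ≡⟨ solve 4 (λ a b c d → a :* b :* (c :* d) := c :* (a :* b :* d)) refl E₁ E₂ (ℕ→ℚ (p ^ suc i)) (pow B (suc i)) ⟩
        ℕ→ℚ (p ^ suc i) * W i                        ∎

    Dcoef-divisible : ∀ rs qs → Admissible rs (Vec.lookup qs Fin.zero)
                    → ∀ {i} → i ≤ 3 → ∀ {k} → 1 ≤ k → k ≤ digit0 p (- Vec.lookup qs Fin.zero) ℕ.+ 1
                    → p^ (3 ∸ i) ∣ Dcoef p rs qs i k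
    Dcoef-divisible rs qs admissible {i} i≤3 {suc k′} _ k≤u+1 =
      subst (λ d → p^ (3 ∸ i) ∣ (numerator * inv d)) (sym (denominator≡ i))
        (p^∣-/ (subst (λ e → p^ e ∣ numerator) 4≡[3∸i]+[1+i] numerator-divisible) (W-unit i))
      where
      open Coefficient rs (Vec.lookup qs Fin.zero) admissible k′ k≤u+1
      4≡[3∸i]+[1+i] : 4 ≡ 3 ∸ i ℕ.+ suc i
      4≡[3∸i]+[1+i] = sym (trans (ℕ.+-suc (3 ∸ i) i) (cong suc (ℕ.m∸n+n≡m i≤3)))

  ∣↥_∣ : ℚ → ℕ
  ∣↥ x ∣ = ℤ.∣ ↥ x ∣

  offset : ℕ → ℚ → ℕ
  offset c x = digit0 c (- x)

  slope : ℕ → ℚ → ℕ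
  slope c x = ∣↥ ℕ→ℚ 12 * dash c x ∣

  -- Checkable at the single number c, these conditions give, for every prime p = 12m + c,
  -- dash p x = dash c x and digit0 p (- x) = slope c x · m + offset c x (see Mod12.periodic).
  Periodic : ℕ → ℚ → Set
  Periodic c x = ↥ x ≡ + ∣↥ x ∣ × ↧ₙ x ∣ 6 ! × ↧ₙ dash c x ∣ 6 !
               × x + ℕ→ℚ (offset c x) ≡ ℕ→ℚ c * dash c x × offset c x < c
               × ℕ→ℚ 12 * dash c x ≡ ℕ→ℚ (slope c x) × slope c x ≤ 12

  periodic? : ∀ c x → Dec (Periodic c x)
  periodic? c x = ↥ x ℤ.≟ + ∣↥ x ∣ ×-dec ↧ₙ x ∣? 6 ! ×-dec ↧ₙ dash c x ∣? 6 !
    ×-dec x + ℕ→ℚ (offset c x) ℚ.≟ ℕ→ℚ c * dash c x ×-dec offset c x ℕ.<? c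
    ×-dec ℕ→ℚ 12 * dash c x ℚ.≟ ℕ→ℚ (slope c x) ×-dec slope c x ℕ.≤? 12

  Minimal : ℕ → List ℚ → ℚ → Set
  Minimal c qs q = All (λ q′ → dash c q ℚ.≤ dash c q′) qs

  AdmissibleAt : ℕ → List ℚ → ℚ → Set
  AdmissibleAt c rs q = ↧ₙ (1ℚ - dash c q) ∣ 6 ! × ∣↥ 1ℚ - dash c q ∣ ∣ 6 !
                      × All (λ r → slope c q ≤ slope c r × offset c q < offset c r) rs

  admissibleAt? : ∀ c rs q → Dec (AdmissibleAt c rs q)
  admissibleAt? c rs q = ↧ₙ (1ℚ - dash c q) ∣? 6 ! ×-dec ∣↥ 1ℚ - dash c q ∣ ∣? 6 !
    ×-dec all? (λ r → slope c q ℕ.≤? slope c r ×-dec offset c q ℕ.<? offset c r) rs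

  Valid : ℕ → Datum → Set
  Valid c d = All (Periodic c) (αOf d) × All (Periodic c) (βOf d)
            × All (λ q → Minimal c (βOf d) q → AdmissibleAt c (αOf d) q) (βOf d)

  valid? : ∀ c d → Dec (Valid c d)
  valid? c d = all? (periodic? c) (αOf d) ×-dec all? (periodic? c) (βOf d)
    ×-dec all? (λ q → all? (λ q′ → dash c q ℚ.≤? dash c q′) (βOf d) →-dec admissibleAt? c (αOf d) q) (βOf d)

  -- 13 and 17 stand for the classes of 1 and 5: the representative c must itself be at least 7.
  residues : List ℕ
  residues = 7 ∷ 11 ∷ 13 ∷ 17 ∷ []

  valid-at-residues : ∀ d → All (λ c → Valid c d) residues
  valid-at-residues d1 = from-yes (all? (λ c → valid? c d1) residues)
  valid-at-residues d2 = from-yes (all? (λ c → valid? c d2) residues)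
  valid-at-residues d3 = from-yes (all? (λ c → valid? c d3) residues)
  valid-at-residues d4 = from-yes (all? (λ c → valid? c d4) residues)
  valid-at-residues d5 = from-yes (all? (λ c → valid? c d5) residues)
  valid-at-residues d6 = from-yes (all? (λ c → valid? c d6) residues)

  p≡12m+c : ∀ {p} → Prime p → 7 ≤ p → Σ ℕ λ m → Σ ℕ λ c → c ∈ residues × p ≡ 12 ℕ.* m ℕ.+ c
  p≡12m+c {p} p-prime 7≤p = classify (p % 12) (p / 12) (m≡m%n+[m/n]*n p 12) (m%n<n p 12)
    (∤p%12 2 (divides 6 refl) (from-yes (2 ℕ.<? 7))) (∤p%12 3 (divides 4 refl) (from-yes (3 ℕ.<? 7)))
    where
    ∤p%12 : ∀ d .{{_ : ℕ.NonTrivial d}} → d ∣ 12 → d < 7 → ¬ d ∣ p % 12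
    ∤p%12 d d∣12 d<7 d∣r = Prime.notComposite p-prime (composite (ℕ.<-≤-trans d<7 7≤p) (∣n∣m%n⇒∣m d∣12 d∣r))
    r+q*12≡12q+r : ∀ r q → r ℕ.+ q ℕ.* 12 ≡ 12 ℕ.* q ℕ.+ r
    r+q*12≡12q+r r q = trans (ℕ.+-comm r (q ℕ.* 12)) (cong (ℕ._+ r) (ℕ.*-comm q 12))
    classify : ∀ r q → p ≡ r ℕ.+ q ℕ.* 12 → r < 12 → ¬ 2 ∣ r → ¬ 3 ∣ r
             → Σ ℕ λ m → Σ ℕ λ c → c ∈ residues × p ≡ 12 ℕ.* m ℕ.+ c
    classify 1  zero    refl _ _ _ = ⊥-elim (ℕ.<⇒≱ (from-yes (1 ℕ.<? 7)) 7≤p)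
    classify 5  zero    refl _ _ _ = ⊥-elim (ℕ.<⇒≱ (from-yes (5 ℕ.<? 7)) 7≤p)
    classify 1  (suc q) p≡ _ _ _ = q , 13 , there (there (here refl)) , trans p≡ (r+q*12≡12q+r 13 q)
    classify 5  (suc q) p≡ _ _ _ = q , 17 , there (there (there (here refl))) , trans p≡ (r+q*12≡12q+r 17 q)
    classify 7  q       p≡ _ _ _ = q , 7 , here refl , trans p≡ (r+q*12≡12q+r 7 q)
    classify 11 q       p≡ _ _ _ = q , 11 , there (here refl) , trans p≡ (r+q*12≡12q+r 11 q)
    classify 0  _ _ _ 2∤ _ = ⊥-elim (2∤ (divides 0 refl))
    classify 2  _ _ _ 2∤ _ = ⊥-elim (2∤ (divides 1 refl))
    classify 4  _ _ _ 2∤ _ = ⊥-elim (2∤ (divides 2 refl))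
    classify 6  _ _ _ 2∤ _ = ⊥-elim (2∤ (divides 3 refl))
    classify 8  _ _ _ 2∤ _ = ⊥-elim (2∤ (divides 4 refl))
    classify 10 _ _ _ 2∤ _ = ⊥-elim (2∤ (divides 5 refl))
    classify 3  _ _ _ _ 3∤ = ⊥-elim (3∤ (divides 1 refl))
    classify 9  _ _ _ _ 3∤ = ⊥-elim (3∤ (divides 3 refl))
    classify (suc (suc (suc (suc (suc (suc (suc (suc (suc (suc (suc (suc n)))))))))))) _ _ r<12 _ _ =
      ⊥-elim (ℕ.<⇒≱ r<12 (ℕ.m≤m+n 12 n))

  module Mod12 {p : ℕ} (p-prime : Prime p) (7≤p : 7 ≤ p) where
    open PAdic p-prime

    p∤n! : ∀ {n} → n < p → ¬ p ∣ n !
    p∤n! {zero}  _   = p∤1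
    p∤n! {suc n} n<p p∣n! = [ p∤n (s≤s z≤n) n<p , p∤n! (ℕ.<-trans (ℕ.n<1+n n) n<p) ]′
      (euclidsLemma (suc n) (n !) p-prime p∣n!)

    ∣6!⇒ℤₚ : ∀ {x} → ↧ₙ x ∣ 6 ! → ℤₚ x
    ∣6!⇒ℤₚ ↧x∣6! = integral λ p∣↧x → p∤n! 7≤p (∣-trans p∣↧x ↧x∣6!)

    ∣6!⇒ℤₚˣ : ∀ {x} → ↧ₙ x ∣ 6 ! → ∣↥ x ∣ ∣ 6 ! → ℤₚˣ x
    ∣6!⇒ℤₚˣ ↧x∣6! ↥x∣6! = unit (∣6!⇒ℤₚ ↧x∣6!) λ p∣↥x → p∤n! 7≤p (∣-trans p∣↥x ↥x∣6!)

    Periodic⇒ℤₚ : ∀ {c} x → Periodic c x → ℤₚ x × ℤₚ (dash c x)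
    Periodic⇒ℤₚ x (_ , ↧x∣6! , ↧x′∣6! , _) = ∣6!⇒ℤₚ {x} ↧x∣6! , ∣6!⇒ℤₚ ↧x′∣6!

    periodic : ∀ {m c} x → p ≡ 12 ℕ.* m ℕ.+ c → Periodic c x
             → digit0 p (- x) ≡ slope c x ℕ.* m ℕ.+ offset c x × dash p x ≡ dash c x
    periodic {m} {c} x p≡ (↥x≡ , ↧x∣6! , ↧x′∣6! , x+e≡cy , e<c , 12y≡S , S≤12) =
      dash-characterisation {x} ↥x≡ (∣6!⇒ℤₚ ↧x∣6!) (∣6!⇒ℤₚ ↧x′∣6!) n<p x+n≡Py
      where
      open ≡-Reasoning
      y = dash c x
      S = slope c x
      e = offset c x
      n<p : S ℕ.* m ℕ.+ e < p
      n<p = subst (S ℕ.* m ℕ.+ e <_) (sym p≡) (ℕ.+-mono-≤-< (ℕ.*-monoˡ-≤ m S≤12) e<c)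
      x+n≡Py : x + ℕ→ℚ (S ℕ.* m ℕ.+ e) ≡ P * y
      x+n≡Py = begin
        x + ℕ→ℚ (S ℕ.* m ℕ.+ e)         ≡⟨ cong (λ z → x + z) (trans (ℕ→ℚ-homo-+ (S ℕ.* m) e) (cong (_+ ℕ→ℚ e) (ℕ→ℚ-homo-* S m))) ⟩
        x + (ℕ→ℚ S * ℕ→ℚ m + ℕ→ℚ e)     ≡⟨ solve 4 (λ x S m e → x :+ (S :* m :+ e) := (x :+ e) :+ S :* m) refl x (ℕ→ℚ S) (ℕ→ℚ m) (ℕ→ℚ e) ⟩
        (x + ℕ→ℚ e) + ℕ→ℚ S * ℕ→ℚ m     ≡⟨ cong₂ (λ u v → u + v * ℕ→ℚ m) x+e≡cy (sym 12y≡S) ⟩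
        ℕ→ℚ c * y + ℕ→ℚ 12 * y * ℕ→ℚ m  ≡⟨ solve 4 (λ c y t m → c :* y :+ t :* y :* m := (t :* m :+ c) :* y) refl (ℕ→ℚ c) y (ℕ→ℚ 12) (ℕ→ℚ m) ⟩
        (ℕ→ℚ 12 * ℕ→ℚ m + ℕ→ℚ c) * y    ≡⟨ cong (_* y) (trans (ℕ→ℚ-homo-+ (12 ℕ.* m) c) (cong (_+ ℕ→ℚ c) (ℕ→ℚ-homo-* 12 m))) ⟨
        ℕ→ℚ (12 ℕ.* m ℕ.+ c) * y        ≡⟨ cong (λ n → ℕ→ℚ n * y) p≡ ⟨
        P * y                           ∎

    Valid⇒Admissible : ∀ {m c d n n′} (rs : Vec ℚ n) (qs : Vec ℚ (suc n′)) → p ≡ 12 ℕ.* m ℕ.+ c → Valid c d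
                     → Vec.toList rs ↭ αOf d → Vec.toList qs ↭ βOf d
                     → (∀ j → dash p (Vec.lookup qs Fin.zero) ℚ.≤ dash p (Vec.lookup qs j))
                     → Admissible rs (Vec.lookup qs Fin.zero)
    Valid⇒Admissible {m} {c} {d} rs (q₁ ∷ _) p≡ (α-periodic , β-periodic , minimal⇒admissible) rs↭α qs↭β q₁-least = record
      { q₁∈ℤₚ        = proj₁ (Periodic⇒ℤₚ q₁ q₁-periodic)
      ; q₁′∈ℤₚ       = subst ℤₚ (sym dash-q₁) (proj₂ (Periodic⇒ℤₚ q₁ q₁-periodic))
      ; 1-q₁′∈ℤₚˣ    = subst (λ y → ℤₚˣ (1ℚ - y)) (sym dash-q₁) (∣6!⇒ℤₚˣ ↧[1-q₁′]∣6! ↥[1-q₁′]∣6!)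
      ; r′∈ℤₚ∧digit> = VAll.toList⁻ (All-resp-↭ (↭-sym rs↭α) (All.zipWith (λ {r} → r-bounds r) (α-periodic , digit-bounds)))
      }
      where
      q₁∈β = ∈-resp-↭ qs↭β (here refl)
      q₁-periodic = All.lookup β-periodic q₁∈β
      digit-q₁ = proj₁ (periodic {m} q₁ p≡ q₁-periodic)
      dash-q₁  = proj₂ (periodic {m} q₁ p≡ q₁-periodic)

      minimal : Minimal c (βOf d) q₁
      minimal = All.zipWith (λ {q′} (q₁′≤q′ , q′-periodic) → subst₂ ℚ._≤_ dash-q₁ (proj₂ (periodic {m} q′ p≡ q′-periodic)) q₁′≤q′)
        (All-resp-↭ qs↭β (VAll.toList⁺ (VAll.lookup⁻ q₁-least)) , β-periodic)

      q₁-admissible = All.lookup minimal⇒admissible q₁∈β minimal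
      ↧[1-q₁′]∣6! = proj₁ q₁-admissible
      ↥[1-q₁′]∣6! = proj₁ (proj₂ q₁-admissible)
      digit-bounds = proj₂ (proj₂ q₁-admissible)

      r-bounds : ∀ r → Periodic c r × (slope c q₁ ≤ slope c r × offset c q₁ < offset c r)
               → ℤₚ (dash p r) × digit0 p (- q₁) < digit0 p (- r)
      r-bounds r (r-periodic , S≤ , e<) =
        subst ℤₚ (sym (proj₂ (periodic {m} r p≡ r-periodic))) (proj₂ (Periodic⇒ℤₚ r r-periodic)) ,
        subst₂ _<_ (sym digit-q₁) (sym (proj₁ (periodic {m} r p≡ r-periodic))) (ℕ.+-mono-≤-< (ℕ.*-monoˡ-≤ m S≤) e<)

    datum-Admissible : ∀ d (rs qs : Vec ℚ 4) → Vec.toList rs ↭ αOf d → Vec.toList qs ↭ βOf d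
                     → (∀ j → dash p (Vec.lookup qs Fin.zero) ℚ.≤ dash p (Vec.lookup qs j))
                     → Admissible rs (Vec.lookup qs Fin.zero)
    datum-Admissible d rs qs rs↭α qs↭β q₁-least with m , c , c∈residues , p≡ ← p≡12m+c p-prime 7≤p =
      Valid⇒Admissible {m} {c} {d} rs qs p≡ (All.lookup (valid-at-residues d) c∈residues) rs↭α qs↭β q₁-least

open Proof using (module PAdic; module Mod12)

open import Defs
open import Data.Nat using (ℕ; _≤_; _∸_; _^_; _+_)
open import Data.Nat using (z≤n)
open import Data.Nat.Properties using (≤-trans; n≤1+n)
open import Data.Nat.Divisibility using (_∣_)
open import Data.Nat.Primality using (Prime)
open import Data.Fin using (Fin)
open import Data.Vec using (Vec; toList; lookup)
open import Data.Rational using (ℚ; ↧ₙ_; _*_)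
open import Data.Rational as ℚ using ()
open import Data.List.Relation.Binary.Permutation.Propositional using (_↭_)
open import Data.Fin using () renaming (_≤_ to _≤ᶠ_)
open import Data.Product using (Σ; _×_; _,_)
open import Relation.Nullary using (¬_)
open import Relation.Binary.PropositionalEquality using (_≡_)

lemma4p7 : (p : ℕ) → Prime p → 7 ≤ p → (d : Datum)
  → (rs qs : Vec ℚ 4)
  → toList rs ↭ αOf d
  → toList qs ↭ βOf d
  → (∀ (j l : Fin 4) → j ≤ᶠ l → dash p (lookup rs j) ℚ.≤ dash p (lookup rs l))
  → (∀ (j l : Fin 4) → j ≤ᶠ l → dash p (lookup qs j) ℚ.≤ dash p (lookup qs l))
  → (i : ℕ) → 1 ≤ i → i ≤ 2
  → (k : ℕ) → 1 ≤ k → k ≤ digit0 p (ℚ.- lookup qs Fin.zero) + 1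
  → Σ ℚ (λ δ → ¬ (p ∣ ↧ₙ δ) × Dcoef p rs qs i k ≡ ℕ→ℚ (p ^ (3 ∸ i)) * δ)
-- The order of rs is irrelevant: every r ∈ α satisfies the digit bound.
lemma4p7 p p-prime 7≤p d rs qs rs↭α qs↭β _ qs-sorted i _ i≤2 k 1≤k k≤u₁+1 =
  quotient , ℤₚ.p∤↧ quotient∈ℤₚ , factorisation
  where
  open PAdic p-prime
  open Mod12 p-prime 7≤p
  q₁-least : ∀ j → dash p (lookup qs Fin.zero) ℚ.≤ dash p (lookup qs j)
  q₁-least j = qs-sorted Fin.zero j z≤n
  open p^_∣_ (Dcoef-divisible rs qs (datum-Admissible d rs qs rs↭α qs↭β q₁-least) (≤-trans i≤2 (n≤1+n 2)) 1≤k k≤u₁+1)
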